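{- Let $G$ be a graph and let $H$ be a perfect matching on $V(G)$ with adjacency matrix $B$. Then there exists a graph $K$ on $V(G)$ such that $G$ is factored into $H$ and $K$ if and only if the involution $\sigma$ of $V(G)$ that swaps the two endpoints of each edge of $H$ (whose permutation matrix is $B$) is an automorphism of $G$ that fixes no edge of $G$, i.e. there is no edge $\{x,y\}$ of $G$ with $\sigma(x)=y$.
   Context: All graphs are finite, simple and undirected. For graphs $H,K$ on the vertex set $V(G)$, $G$ is factored into $H$ and $K$ if $A=BC$, where $A,B,C$ are the adjacency matrices of $G,H,K$ with respect to one common ordering of the vertices. A perfect matching is a $1$-regular spanning graph. -}

module Defs where

open import Data.Nat using (ℕ; zero; suc; _+_; _*_)
open import Data.Fin using (Fin; zero; suc)
open import Data.Bool using (Bool; true; false; if_then_else_)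
open import Relation.Binary.PropositionalEquality using (_≡_)
open import Function.Definitions using (Injective; Surjective)

sumFin : (n : ℕ) → (Fin n → ℕ) → ℕ
sumFin zero    f = 0
sumFin (suc n) f = f zero + sumFin n (λ k → f (suc k))

record Graph (n : ℕ) : Set where
  field
    adj    : Fin n → Fin n → Bool
    sym    : ∀ x y → adj x y ≡ adj y x
    irrefl : ∀ x → adj x x ≡ false
open Graph public

Matrix : ℕ → Set
Matrix n = Fin n → Fin n → ℕ

adjMat : ∀ {n} → Graph n → Matrix n
adjMat G i j = if adj G i j then 1 else 0

_⊗_ : ∀ {n} → Matrix n → Matrix n → Matrix n
_⊗_ {n} B C i j = sumFin n (λ k → B i k * C k j)

FactoredInto : ∀ {n} → Graph n → Graph n → Graph n → Set
FactoredInto G H K = ∀ i j → adjMat G i j ≡ (adjMat H ⊗ adjMat K) i j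

degree : ∀ {n} → Graph n → Fin n → ℕ
degree {n} G x = sumFin n (λ y → adjMat G x y)

IsPerfectMatching : ∀ {n} → Graph n → Set
IsPerfectMatching G = ∀ x → degree G x ≡ 1

IsAutomorphism : ∀ {n} → Graph n → (Fin n → Fin n) → Set
IsAutomorphism G σ =
  Injective _≡_ _≡_ σ × Surjective _≡_ _≡_ σ × (∀ x y → adj G x y ≡ adj G (σ x) (σ y))
  where open import Data.Product using (_×_)

FixesNoEdge : ∀ {n} → Graph n → (Fin n → Fin n) → Set
FixesNoEdge G σ = ∀ x y → adj G x y ≡ true → σ x ≡ y → ⊥
  where open import Data.Empty using (⊥)

module Submission where

-- The adjacency matrix B of a perfect matching is the permutation matrix of the partner
-- involution σ, so B C is C with its rows permuted by σ. Since B² = I, the only candidate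
-- factor is K = B A, i.e. adj K k j = adj G (σ k) j, and it is a graph (symmetric with empty
-- diagonal) exactly when σ preserves adjacency in G and no edge of G joins x to σ x.

open import Defs hiding (sym)
open import Data.Nat using (ℕ; zero; suc; _+_; _*_; _≤_; s≤s)
open import Data.Nat.Properties using (m≤m+n; m≤n+m; ≤-trans; +-monoʳ-≤; +-comm; +-identityʳ; *-identityˡ)
open import Data.Fin using (Fin; zero; suc; _≟_)
open import Data.Fin.Properties using (suc-injective)
open import Data.Bool using (Bool; true; false; if_then_else_)
open import Data.Product using (Σ; _×_; _,_)
open import Relation.Nullary using (yes; no; contradiction)
open import Relation.Binary.PropositionalEquality
  using (_≡_; _≢_; refl; sym; trans; cong; cong₂; subst; subst₂; module ≡-Reasoning)
open import Algebra.Definitions using (Involutive; SelfInverse)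
open import Algebra.Consequences.Propositional using (selfInverse⇒involutive; selfInverse⇒bijective)
open import Function.Bundles using (_⇔_; mk⇔; module Equivalence)

indicator : Bool → ℕ
indicator b = if b then 1 else 0

indicator-injective : ∀ b c → indicator b ≡ indicator c → b ≡ c
indicator-injective true  true  _ = refl
indicator-injective false false _ = refl

sumFin-zero : ∀ n (g : Fin n → ℕ) → (∀ k → g k ≡ 0) → sumFin n g ≡ 0
sumFin-zero zero    g _  = refl
sumFin-zero (suc n) g g0 rewrite g0 zero = sumFin-zero n (λ k → g (suc k)) (λ k → g0 (suc k))

sumFin-single : ∀ n (g : Fin n → ℕ) a → (∀ k → k ≢ a → g k ≡ 0) → sumFin n g ≡ g a
sumFin-single (suc n) g zero g0 =
  trans (cong (g zero +_) (sumFin-zero n (λ k → g (suc k)) (λ k → g0 (suc k) λ ())))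
        (+-identityʳ (g zero))
sumFin-single (suc n) g (suc a) g0 rewrite g0 zero (λ ()) =
  sumFin-single n (λ k → g (suc k)) a (λ k k≢a → g0 (suc k) (λ e → k≢a (suc-injective e)))

term≤sumFin : ∀ n (g : Fin n → ℕ) k → g k ≤ sumFin n g
term≤sumFin (suc n) g zero    = m≤m+n (g zero) _
term≤sumFin (suc n) g (suc k) = ≤-trans (term≤sumFin n (λ j → g (suc j)) k) (m≤n+m _ (g zero))

twoTerms≤sumFin : ∀ n (g : Fin n → ℕ) a k → a ≢ k → g a + g k ≤ sumFin n g
twoTerms≤sumFin (suc n) g zero    zero    a≢k = contradiction refl a≢k
twoTerms≤sumFin (suc n) g zero    (suc k) _   = +-monoʳ-≤ (g zero) (term≤sumFin n (λ j → g (suc j)) k)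
twoTerms≤sumFin (suc n) g (suc a) zero    _   =
  subst (_≤ sumFin (suc n) g) (+-comm (g zero) (g (suc a)))
        (+-monoʳ-≤ (g zero) (term≤sumFin n (λ j → g (suc j)) a))
twoTerms≤sumFin (suc n) g (suc a) (suc k) a≢k =
  ≤-trans (twoTerms≤sumFin n (λ j → g (suc j)) a k (λ e → a≢k (cong suc e))) (m≤n+m _ (g zero))

RowPermuted : ∀ {n} → Graph n → Graph n → (Fin n → Fin n) → Set
RowPermuted G K σ = ∀ i j → adj G i j ≡ adj K (σ i) j

module _ {n} (G K : Graph n) {σ : Fin n → Fin n} (rows : RowPermuted G K σ) where

  rowPermuted⇒fixesNoEdge : FixesNoEdge G σ
  rowPermuted⇒fixesNoEdge x _ edge refl =
    contradiction (trans (sym edge) (trans (rows x (σ x)) (irrefl K (σ x)))) λ ()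

  rowPermuted⇒preserves : Involutive _≡_ σ → ∀ x y → adj G x y ≡ adj G (σ x) (σ y)
  rowPermuted⇒preserves σσ x y = begin
    adj G x y                 ≡⟨ rows x y ⟩
    adj K (σ x) y             ≡⟨ Graph.sym K (σ x) y ⟩
    adj K y (σ x)             ≡⟨ cong (λ z → adj K z (σ x)) (sym (σσ y)) ⟩
    adj K (σ (σ y)) (σ x)     ≡⟨ sym (rows (σ y) (σ x)) ⟩
    adj G (σ y) (σ x)         ≡⟨ Graph.sym G (σ y) (σ x) ⟩
    adj G (σ x) (σ y)         ∎
    where open ≡-Reasoning

module _ {n} (G : Graph n) (σ : Fin n → Fin n) (σσ : Involutive _≡_ σ)
         (preserves : ∀ x y → adj G x y ≡ adj G (σ x) (σ y)) (noEdge : FixesNoEdge G σ) where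

  permuteRows : Graph n
  permuteRows = record { adj = λ k j → adj G (σ k) j ; sym = symmetric ; irrefl = irreflexive }
    where
    symmetric : ∀ k j → adj G (σ k) j ≡ adj G (σ j) k
    symmetric k j = begin
      adj G (σ k) j             ≡⟨ preserves (σ k) j ⟩
      adj G (σ (σ k)) (σ j)     ≡⟨ cong (λ z → adj G z (σ j)) (σσ k) ⟩
      adj G k (σ j)             ≡⟨ Graph.sym G k (σ j) ⟩
      adj G (σ j) k             ∎
      where open ≡-Reasoning
    irreflexive : ∀ k → adj G (σ k) k ≡ false
    irreflexive k with adj G (σ k) k in edge
    ... | false = refl
    ... | true  = contradiction refl (noEdge k (σ k) (trans (Graph.sym G k (σ k)) edge))

  permuteRows-rowPermuted : RowPermuted G permuteRows σ
  permuteRows-rowPermuted i j = cong (λ z → adj G z j) (sym (σσ i))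

module PerfectMatching {n} (H : Graph n) (perfect : IsPerfectMatching H)
                       (σ : Fin n → Fin n) (partner : ∀ x → adj H x (σ x) ≡ true) where

  neighbour-unique : ∀ x k → adj H x k ≡ true → k ≡ σ x
  neighbour-unique x k edge with σ x ≟ k
  ... | yes σx≡k = sym σx≡k
  ... | no  σx≢k = contradiction two≤one λ { (s≤s ()) }
    where
    two≤one : 2 ≤ 1
    two≤one = subst₂ _≤_ (cong₂ _+_ (cong indicator (partner x)) (cong indicator edge)) (perfect x)
                         (twoTerms≤sumFin n (adjMat H x) (σ x) k σx≢k)

  non-neighbour : ∀ x k → k ≢ σ x → adj H x k ≡ false
  non-neighbour x k k≢σx with adj H x k in edge
  ... | false = refl
  ... | true  = contradiction (neighbour-unique x k edge) k≢σx

  partner-selfInverse : SelfInverse _≡_ σ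
  partner-selfInverse {x} refl = sym (neighbour-unique (σ x) x (trans (Graph.sym H (σ x) x) (partner x)))

  partner-involutive : Involutive _≡_ σ
  partner-involutive = selfInverse⇒involutive partner-selfInverse

  matching-⊗ : (C : Matrix n) → ∀ i j → (adjMat H ⊗ C) i j ≡ C (σ i) j
  matching-⊗ C i j = begin
    sumFin n (λ k → adjMat H i k * C k j)   ≡⟨ sumFin-single n _ (σ i) off-partner ⟩
    adjMat H i (σ i) * C (σ i) j            ≡⟨ cong (λ b → indicator b * C (σ i) j) (partner i) ⟩
    1 * C (σ i) j                           ≡⟨ *-identityˡ (C (σ i) j) ⟩
    C (σ i) j                               ∎
    where
    open ≡-Reasoning
    off-partner : ∀ k → k ≢ σ i → adjMat H i k * C k j ≡ 0
    off-partner k k≢σi rewrite non-neighbour i k k≢σi = refl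

  factoredInto⇔rowPermuted : ∀ G K → FactoredInto G H K ⇔ RowPermuted G K σ
  factoredInto⇔rowPermuted G K = mk⇔
    (λ fac i j → indicator-injective _ _ (trans (fac i j) (matching-⊗ (adjMat K) i j)))
    (λ rows i j → trans (cong indicator (rows i j)) (sym (matching-⊗ (adjMat K) i j)))

mainTheorem5 : (n : ℕ) (G H : Graph n) → IsPerfectMatching H →
    (σ : Fin n → Fin n) → (∀ x → adj H x (σ x) ≡ true) →
    (Σ (Graph n) (λ K → FactoredInto G H K)) ⇔ (IsAutomorphism G σ × FixesNoEdge G σ)
mainTheorem5 n G H perfect σ partner = mk⇔ factored⇒automorphism automorphism⇒factored
  where
  open PerfectMatching H perfect σ partner

  factored⇒automorphism : Σ (Graph n) (FactoredInto G H) → IsAutomorphism G σ × FixesNoEdge G σ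
  factored⇒automorphism (K , fac) =
    let rows = Equivalence.to (factoredInto⇔rowPermuted G K) fac
        (injective , surjective) = selfInverse⇒bijective partner-selfInverse
    in (injective , surjective , rowPermuted⇒preserves G K rows partner-involutive)
       , rowPermuted⇒fixesNoEdge G K rows

  automorphism⇒factored : IsAutomorphism G σ × FixesNoEdge G σ → Σ (Graph n) (FactoredInto G H)
  automorphism⇒factored ((_ , _ , preserves) , noEdge) =
    K , Equivalence.from (factoredInto⇔rowPermuted G K) (permuteRows-rowPermuted G σ partner-involutive preserves noEdge)
    where
    K : Graph n
    K = permuteRows G σ partner-involutive preserves noEdge
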